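{- (Upward derivability for the ability fragment of CL.) Let $\gamma$ be an elementary disjunction, $PI$ a finite index set, and for each $j\in PI$ let $B_j$ be a coalition and $\psi_j\in\Phi_{\mathsf{CL}_{AB}}$; let $PI^0=\{j\in PI\mid B_j=Ag\}$. Suppose that either $\vdash_{\mathsf{CL}_{AB}}\gamma$, or there is $j'\in PI$ with $\vdash_{\mathsf{CL}_{AB}}\bigvee_{j\in PI^0}\psi_j\vee\psi_{j'}$. Then $\vdash_{\mathsf{CL}_{AB}}\gamma\vee\bigvee_{j\in PI}\langle B_j\rangle\psi_j$.
   Context: Fix a nonempty finite set $Ag$ of agents and a countable set $AP$ of atoms; a coalition is a subset of $Ag$. $\Phi_{\mathsf{CL}_{AB}}$: $\phi::=\top\mid\bot\mid p\mid\neg p\mid(\phi\wedge\phi)\mid(\phi\vee\phi)\mid\langle A\rangle\phi$. An elementary disjunction is a disjunction of literals; the empty disjunction is $\bot$. $\vdash_{\mathsf{CL}_{AB}}\phi$ means $\phi$ is derivable in the system whose axioms are the propositional tautologies in $\Phi_{\mathsf{CL}_{AB}}$ and whose rules are: R1: from $\phi_1,\dots,\phi_n$ infer $\psi$ where $(\phi_1\wedge\dots\wedge\phi_n)\to\psi$ is a propositional tautology; R2: from $\phi$ infer $\langle A\rangle\phi$; R3: from $\langle A\rangle(\phi_1\vee\phi_2)\vee\chi$ infer $\langle A\rangle\phi_1\vee\langle Ag\rangle\phi_2\vee\chi$. -}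

module Defs where

open import Data.Nat using (ℕ; suc)
open import Data.Bool using (Bool; true; false; not; _∧_; _∨_)
open import Data.Fin using (Fin)
open import Data.Fin.Subset using (Subset) renaming (⊤ to Full)
open import Data.List using (List; []; _∷_; map; filter; _++_; [_])
open import Data.List.Relation.Unary.All using (All)
open import Data.Product using (Σ; _×_; _,_)
open import Data.Vec.Properties using (≡-dec)
import Data.Bool.Properties as BP
open import Relation.Binary.PropositionalEquality using (_≡_)
open import Relation.Nullary using (Dec)

-- Agents: Ag = Fin n (nonemptiness imposed in the theorem via n = suc m).
-- Coalitions: subsets of Ag.  Atoms: ℕ (countable).
Coalition : ℕ → Set
Coalition n = Subset n

-- Formulas of Φ_{CL_AB} (negation normal form, negation only on atoms)
infixr 5 _∨ᶠ_
infixr 6 _∧ᶠ_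
data Fm (n : ℕ) : Set where
  ⊤ᶠ ⊥ᶠ : Fm n
  atom natom : ℕ → Fm n
  _∧ᶠ_ _∨ᶠ_ : Fm n → Fm n → Fm n
  ⟨_⟩_ : Coalition n → Fm n → Fm n

-- Propositional evaluation: modal formulas ⟨A⟩φ are treated as
-- propositional atoms, valued by w.
eval : ∀ {n} → (ℕ → Bool) → (Coalition n → Fm n → Bool) → Fm n → Bool
eval v w ⊤ᶠ = true
eval v w ⊥ᶠ = false
eval v w (atom p) = v p
eval v w (natom p) = not (v p)
eval v w (φ ∧ᶠ ψ) = eval v w φ ∧ eval v w ψ
eval v w (φ ∨ᶠ ψ) = eval v w φ ∨ eval v w ψ
eval v w (⟨ A ⟩ φ) = w A φ

Taut : ∀ {n} → Fm n → Set
Taut {n} φ = ∀ (v : ℕ → Bool) (w : Coalition n → Fm n → Bool) → eval v w φ ≡ true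

TautImp : ∀ {n} → List (Fm n) → Fm n → Set
TautImp {n} φs ψ = ∀ (v : ℕ → Bool) (w : Coalition n → Fm n → Bool) →
  All (λ φ → eval v w φ ≡ true) φs → eval v w ψ ≡ true

-- Derivability in CL_AB over agents Fin n (Ag = Full)
data ⊢_ {n : ℕ} : Fm n → Set where
  ax : ∀ {φ} → Taut φ → ⊢ φ
  R1 : ∀ {φs ψ} → All ⊢_ φs → TautImp φs ψ → ⊢ ψ
  R2 : ∀ {A φ} → ⊢ φ → ⊢ (⟨ A ⟩ φ)
  R3 : ∀ {A φ₁ φ₂ χ} → ⊢ ((⟨ A ⟩ (φ₁ ∨ᶠ φ₂)) ∨ᶠ χ) →
       ⊢ ((⟨ A ⟩ φ₁) ∨ᶠ ((⟨ Full ⟩ φ₂) ∨ᶠ χ))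

⋁ : ∀ {n} → List (Fm n) → Fm n
⋁ [] = ⊥ᶠ
⋁ (φ ∷ []) = φ
⋁ (φ ∷ φs@(_ ∷ _)) = φ ∨ᶠ ⋁ φs

data Literal : Set where
  pos neg : ℕ → Literal

litFm : ∀ {n} → Literal → Fm n
litFm (pos p) = atom p
litFm (neg p) = natom p

elemDisj : ∀ {n} → List Literal → List (Fm n)
elemDisj ls = map litFm ls

PI0 : ∀ {n k} → (Fin k → Coalition n) → List (Fin k) → List (Fin k)
PI0 B js = filter (λ j → ≡-dec BP._≟_ (B j) Full) js

{-# OPTIONS --safe #-}
module Submission where

-- Modal formulas are opaque atoms for propositional reasoning,
-- so every rearrangement of disjunctions is an instance of R1.  From
-- ⊢ ψ_{j′} ∨ ⋁_{i∈PI⁰} ψ_i, bracketed to the left, R2 gives ⊢ ⟨B_{j′}⟩(…),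
-- and each application of R3 peels the outermost disjunct ψ_i off into a
-- separate disjunct ⟨Ag⟩ψ_i, which is one of the ⟨B_i⟩ψ_i because i ∈ PI⁰.
-- What remains is weakening of a disjunction by further disjuncts.

open import Defs
open import Data.Nat using (ℕ; suc)
open import Data.Bool using (Bool; true; false; _∨_)
open import Data.Fin using (Fin)
open import Data.Fin.Subset using () renaming (⊤ to Full)
open import Data.List using (List; []; _∷_; map; foldl; foldr; _++_; [_])
open import Data.List.Base using (allFin)
open import Data.List.Relation.Unary.All using ([]; _∷_)
open import Data.List.Relation.Unary.Any using (Any; here; there)
open import Data.List.Relation.Unary.Any.Properties using (++⁻; singleton⁻)
open import Data.List.Membership.Propositional using (_∈_)
open import Data.List.Membership.Propositional.Properties
  using (∈-map⁺; ∈-map⁻; ∈-filter⁻; ∈-allFin)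
open import Data.List.Relation.Binary.Subset.Propositional using (_⊆_)
open import Data.List.Relation.Binary.Subset.Propositional.Properties
  using (Any-resp-⊆; ⊆-trans; xs⊆xs++ys; xs⊆ys++xs)
open import Data.Product using (Σ; _,_; uncurry)
open import Data.Sum using (_⊎_; inj₁; inj₂)
import Data.Sum as Sum
open import Data.Vec.Properties using (≡-dec)
import Data.Bool.Properties as BP
open import Function using (_∘_)
open import Relation.Binary.PropositionalEquality using (_≡_; refl; subst)

∨≡true⁻ : ∀ {a b : Bool} → a ∨ b ≡ true → a ≡ true ⊎ b ≡ true
∨≡true⁻ {true}  _ = inj₁ refl
∨≡true⁻ {false} e = inj₂ e

∨≡true⁺ˡ : ∀ {a b : Bool} → a ≡ true → a ∨ b ≡ true
∨≡true⁺ˡ refl = refl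

∨≡true⁺ʳ : ∀ {a b : Bool} → b ≡ true → a ∨ b ≡ true
∨≡true⁺ʳ {true}  _ = refl
∨≡true⁺ʳ {false} e = e

module Valuation {n : ℕ} (v : ℕ → Bool) (w : Coalition n → Fm n → Bool) where

  Holds : Fm n → Set
  Holds φ = eval v w φ ≡ true

  ⋁-holds⁻ : ∀ φs → Holds (⋁ φs) → Any Holds φs
  ⋁-holds⁻ []               ()
  ⋁-holds⁻ (φ ∷ [])         h = here h
  ⋁-holds⁻ (φ ∷ φs@(_ ∷ _)) h = Sum.[ here , there ∘ ⋁-holds⁻ φs ]′ (∨≡true⁻ {eval v w φ} h)

  ⋁-holds⁺ : ∀ φs → Any Holds φs → Holds (⋁ φs)
  ⋁-holds⁺ (φ ∷ [])         (here h)  = h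
  ⋁-holds⁺ (φ ∷ φs@(_ ∷ _)) (here h)  = ∨≡true⁺ˡ h
  ⋁-holds⁺ (φ ∷ φs@(_ ∷ _)) (there h) = ∨≡true⁺ʳ {eval v w φ} (⋁-holds⁺ φs h)

  foldl-∨-holds⁺ : ∀ φ φs → Holds φ ⊎ Any Holds φs → Holds (foldl _∨ᶠ_ φ φs)
  foldl-∨-holds⁺ φ []       (inj₁ h)         = h
  foldl-∨-holds⁺ φ (ψ ∷ φs) (inj₁ h)         = foldl-∨-holds⁺ (φ ∨ᶠ ψ) φs (inj₁ (∨≡true⁺ˡ h))
  foldl-∨-holds⁺ φ (ψ ∷ φs) (inj₂ (here h))  = foldl-∨-holds⁺ (φ ∨ᶠ ψ) φs (inj₁ (∨≡true⁺ʳ {eval v w φ} h))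
  foldl-∨-holds⁺ φ (ψ ∷ φs) (inj₂ (there h)) = foldl-∨-holds⁺ (φ ∨ᶠ ψ) φs (inj₂ h)

  foldr-∨-holds⁻ : ∀ φs → Holds (foldr _∨ᶠ_ ⊥ᶠ φs) → Any Holds φs
  foldr-∨-holds⁻ []       ()
  foldr-∨-holds⁻ (φ ∷ φs) h = Sum.[ here , there ∘ foldr-∨-holds⁻ φs ]′ (∨≡true⁻ {eval v w φ} h)

open Valuation

infix 4 _⊨_
_⊨_ : ∀ {n} → Fm n → Fm n → Set
φ ⊨ ψ = ∀ v w → Holds v w φ → Holds v w ψ

⊢-resp-⊨ : ∀ {n} {φ ψ : Fm n} → φ ⊨ ψ → ⊢ φ → ⊢ ψ
⊢-resp-⊨ φ⊨ψ ⊢φ = R1 (⊢φ ∷ []) λ { v w (h ∷ []) → φ⊨ψ v w h }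

⋁-mono : ∀ {n} {φs ψs : List (Fm n)} → φs ⊆ ψs → ⋁ φs ⊨ ⋁ ψs
⋁-mono {φs = φs} {ψs} φs⊆ψs v w h = ⋁-holds⁺ v w ψs (Any-resp-⊆ φs⊆ψs (⋁-holds⁻ v w φs h))

R3-iterated : ∀ {n} (A : Coalition n) (φ : Fm n) (φs : List (Fm n)) (χ : Fm n) →
  ⊢ ((⟨ A ⟩ foldl _∨ᶠ_ φ φs) ∨ᶠ χ) →
  ⊢ ((⟨ A ⟩ φ) ∨ᶠ foldr _∨ᶠ_ χ (map (⟨ Full ⟩_) φs))
R3-iterated A φ []       χ ⊢φ = ⊢φ
R3-iterated A φ (ψ ∷ φs) χ ⊢φ = R3 (R3-iterated A (φ ∨ᶠ ψ) φs χ ⊢φ)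

⋁-snoc⊨foldl-∨ : ∀ {n} (φs : List (Fm n)) φ → ⋁ (φs ++ [ φ ]) ⊨ foldl _∨ᶠ_ φ φs
⋁-snoc⊨foldl-∨ φs φ v w h =
  foldl-∨-holds⁺ v w φ φs (Sum.swap (Sum.map₂ singleton⁻ (++⁻ φs (⋁-holds⁻ v w (φs ++ [ φ ]) h))))

foldr-∨⊨⋁ : ∀ {n} {φs ψs : List (Fm n)} → φs ⊆ ψs → foldr _∨ᶠ_ ⊥ᶠ φs ⊨ ⋁ ψs
foldr-∨⊨⋁ {φs = φs} {ψs} φs⊆ψs v w h =
  ⋁-holds⁺ v w ψs (Any-resp-⊆ φs⊆ψs (foldr-∨-holds⁻ v w φs h))

modalities-PI0-⊆ : ∀ {n k} (B : Fin k → Coalition n) (ψ : Fin k → Fm n) {j′ js} → j′ ∈ js →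
  ⟨ B j′ ⟩ ψ j′ ∷ map (⟨ Full ⟩_) (map ψ (PI0 B js)) ⊆ map (λ j → ⟨ B j ⟩ ψ j) js
modalities-PI0-⊆ B ψ j′∈js (here refl) = ∈-map⁺ (λ j → ⟨ B j ⟩ ψ j) j′∈js
modalities-PI0-⊆ B ψ {js = js} j′∈js (there θ∈) with ∈-map⁻ (⟨ Full ⟩_) θ∈
... | _ , ψj∈ , refl with ∈-map⁻ ψ ψj∈
... | j , j∈PI0 , refl with ∈-filter⁻ (λ j → ≡-dec BP._≟_ (B j) Full) {xs = js} j∈PI0
... | j∈js , Bj≡Full = subst (λ A → ⟨ A ⟩ ψ j ∈ map (λ j → ⟨ B j ⟩ ψ j) js) Bj≡Full
                             (∈-map⁺ (λ j → ⟨ B j ⟩ ψ j) j∈js)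

mainTheorem13 : ∀ {m k : ℕ} (γ : List Literal)
    (B : Fin k → Coalition (suc m)) (ψ : Fin k → Fm (suc m)) →
    (⊢ ⋁ (elemDisj {suc m} γ))
      ⊎ Σ (Fin k) (λ j′ → ⊢ ⋁ (map ψ (PI0 B (allFin k)) ++ [ ψ j′ ])) →
    ⊢ ⋁ (elemDisj γ ++ map (λ j → ⟨ B j ⟩ ψ j) (allFin k))
mainTheorem13 {k = k} γ B ψ = Sum.[ weaken-γ , uncurry weaken-ability ]′
  where
  abilities : List (Fm _)
  abilities = map (λ j → ⟨ B j ⟩ ψ j) (allFin k)

  ψsᴾᴵ⁰ : List (Fm _)
  ψsᴾᴵ⁰ = map ψ (PI0 B (allFin k))

  weaken-γ : ⊢ ⋁ (elemDisj γ) → ⊢ ⋁ (elemDisj γ ++ abilities)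
  weaken-γ = ⊢-resp-⊨ (⋁-mono (xs⊆xs++ys (elemDisj γ) abilities))

  weaken-ability : ∀ j′ → ⊢ ⋁ (ψsᴾᴵ⁰ ++ [ ψ j′ ]) → ⊢ ⋁ (elemDisj γ ++ abilities)
  weaken-ability j′ ⊢ψs = ⊢-resp-⊨ (foldr-∨⊨⋁ ⊆disjuncts) ⊢peeled
    where
    ⊢ability : ⊢ ((⟨ B j′ ⟩ foldl _∨ᶠ_ (ψ j′) ψsᴾᴵ⁰) ∨ᶠ ⊥ᶠ)
    ⊢ability = ⊢-resp-⊨ (λ _ _ → ∨≡true⁺ˡ) (R2 (⊢-resp-⊨ (⋁-snoc⊨foldl-∨ ψsᴾᴵ⁰ (ψ j′)) ⊢ψs))

    ⊢peeled : ⊢ foldr _∨ᶠ_ ⊥ᶠ (⟨ B j′ ⟩ ψ j′ ∷ map (⟨ Full ⟩_) ψsᴾᴵ⁰)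
    ⊢peeled = R3-iterated (B j′) (ψ j′) ψsᴾᴵ⁰ ⊥ᶠ ⊢ability

    ⊆disjuncts : ⟨ B j′ ⟩ ψ j′ ∷ map (⟨ Full ⟩_) ψsᴾᴵ⁰ ⊆ elemDisj γ ++ abilities
    ⊆disjuncts = ⊆-trans (modalities-PI0-⊆ B ψ (∈-allFin j′)) (xs⊆ys++xs abilities (elemDisj γ))
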